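{- Let $G$ be a graph and let $D=(P_0,\dots,P_{m-n})$ be a (2,1)-edge-order of $G$ through $rt$ and avoiding $ru$. Then for every vertex $v$ of $G$, the ear $P_{last(v)}$ has $v$ as an endpoint. Moreover, for every edge $vw$ of $G$ with $last(v)=last(w)=birth(vw)$, we have $vw=ru$.
   Context: Graphs are finite and undirected and may contain parallel edges and self-loops; cycles may have length one or two. Let $G=(V,E)$, $n=|V|$, $m=|E|$. An ear decomposition of $G$ is a sequence $(P_0,P_1,\dots,P_k)$ of subgraphs of $G$ that partition $E$ such that (i) $P_0$ is a cycle that is not a self-loop, and (ii) every $P_i$, $1\le i\le k$, is either a path that intersects $P_0\cup\dots\cup P_{i-1}$ exactly in its endpoints, or a cycle that intersects $P_0\cup\dots\cup P_{i-1}$ in exactly one vertex $q_i$ (also called an endpoint of $P_i$). Each $P_i$ is an ear; it is short if it is a single edge and long otherwise. An ear decomposition has $m-n+1$ ears, indexed $0,\dots,m-n$. Let $G_i:=P_0\cup\dots\cup P_i$ with edge set $E_i$, and let $\overline{G_i}$ be the subgraph of $G$ induced by the edge set $E-E_i$. Let $inner(P_i):=V(P_i)-V(G_{i-1})$ (all vertices of $P_0$ are inner); every vertex is an inner vertex of exactly one ear. For an edge $e$, $birth(e)$ is the index $i$ with $e\in P_i$; for a vertex $v$, $birth(v)$ is the index $i$ such that $v\in inner(P_i)$, and $last(v)$ is the maximum of $birth(vw)$ over all edges $vw$ incident to $v$. Given distinct edges $rt$ and $ru$ of $G$ ($t=u$ allowed), a (2,1)-edge-order through $rt$ and avoiding $ru$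 is an ear decomposition $D=(P_0,\dots,P_{m-n})$ of $G$ such that (1) $rt\in P_0$; (2) $P_{m-n}$ is the short ear $ru$; (3) for every $0\le i<m-n$, $\overline{G_i}$ contains all vertices of $inner(P_i)$ and, if $P_i$ is short, at least one endpoint of $P_i$. -}

module Defs where

open import Data.Nat using (ℕ; suc) renaming (_≤_ to _≤ℕ_)
open import Data.Fin using (Fin; zero; suc; toℕ; inject₁; fromℕ; _<_; _≤_)
open import Data.Product using (_×_; _,_; proj₁; proj₂; ∃; ∃-syntax)
open import Data.Sum using (_⊎_)
open import Relation.Binary.PropositionalEquality using (_≡_)
open import Relation.Nullary using (¬_)
open import Function using (_∘_)
open import Function.Definitions using (Injective)

-- A finite multigraph (parallel edges and self-loops allowed):
-- vertices Fin nV, edges Fin nE, each edge has an (unordered) pair of ends.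
record Graph : Set where
  field
    nV nE : ℕ
    ends  : Fin nE → Fin nV × Fin nV
open Graph public

Joins : (G : Graph) → Fin (nE G) → Fin (nV G) → Fin (nV G) → Set
Joins G e x y = ends G e ≡ (x , y) ⊎ ends G e ≡ (y , x)

Incident : (G : Graph) → Fin (nE G) → Fin (nV G) → Set
Incident G e v = proj₁ (ends G e) ≡ v ⊎ proj₂ (ends G e) ≡ v

record Walk (G : Graph) : Set where
  field
    len   : ℕ
    vert  : Fin (suc len) → Fin (nV G)
    edge  : Fin len → Fin (nE G)
    joins : ∀ j → Joins G (edge j) (vert (inject₁ j)) (vert (suc j))
open Walk public

start end : {G : Graph} → Walk G → Fin (nV G)
start W = vert W zero
end   W = vert W (fromℕ (len W))

IsPath : {G : Graph} → Walk G → Set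
IsPath W = 1 ≤ℕ len W × Injective _≡_ _≡_ (vert W)

-- a cycle (length one = self-loop, length two = pair of parallel edges allowed)
IsCycle : {G : Graph} → Walk G → Set
IsCycle W = 1 ≤ℕ len W × start W ≡ end W
          × Injective _≡_ _≡_ (vert W ∘ inject₁) × Injective _≡_ _≡_ (edge W)

OnWalk : {G : Graph} → Walk G → Fin (nV G) → Set
OnWalk W v = ∃[ j ] vert W j ≡ v

-- v is an endpoint of the ear W (for a cycle ear both coincide with q_i)
IsEndpoint : {G : Graph} → Walk G → Fin (nV G) → Set
IsEndpoint W v = v ≡ start W ⊎ v ≡ end W

-- v ∈ V(G_{i-1}) given the ears before index i
InPrev : {G : Graph} {k : ℕ} → (Fin (suc k) → Walk G) → Fin (suc k) → Fin (nV G) → Set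
InPrev ear i v = ∃[ i' ] (i' < i × OnWalk (ear i') v)

record EarDecomposition (G : Graph) : Set where
  field
    k   : ℕ
    ear : Fin (suc k) → Walk G
    ear0-cycle : IsCycle (ear zero)
    ear0-len   : 2 ≤ℕ len (ear zero)
    earᵢ-shape  : ∀ (i : Fin (suc k)) → zero {k} < i → IsPath (ear i) ⊎ IsCycle (ear i)
    earᵢ-start  : ∀ (i : Fin (suc k)) → zero {k} < i → InPrev ear i (start (ear i))
    earᵢ-end    : ∀ (i : Fin (suc k)) → zero {k} < i → InPrev ear i (end (ear i))
    earᵢ-inner  : ∀ (i : Fin (suc k)) → zero {k} < i → ∀ j → InPrev ear i (vert (ear i) j)
                    → j ≡ zero ⊎ j ≡ fromℕ (len (ear i))
    edge-cover  : ∀ e → ∃[ i ] ∃[ j ] edge (ear i) j ≡ e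
    edge-unique : ∀ i i' j j' → edge (ear i) j ≡ edge (ear i') j' → i ≡ i' × toℕ j ≡ toℕ j'
    vert-cover  : ∀ v → ∃[ i ] OnWalk (ear i) v
open EarDecomposition public

module _ {G : Graph} (D : EarDecomposition G) where

  lastIdx : Fin (suc (k D))
  lastIdx = fromℕ (k D)

  Born : Fin (nE G) → Fin (suc (k D)) → Set
  Born e i = ∃[ j ] edge (ear D i) j ≡ e

  Inner : Fin (nV G) → Fin (suc (k D)) → Set
  Inner v i = OnWalk (ear D i) v × ¬ InPrev (ear D) i v

  IsLast : Fin (nV G) → Fin (suc (k D)) → Set
  IsLast v i = (∃[ e ] (Incident G e v × Born e i))
             × (∀ e i' → Incident G e v → Born e i' → i' ≤ i)

  -- v is a vertex of the complement graph \overline{G_i}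
  InRest : Fin (suc (k D)) → Fin (nV G) → Set
  InRest i v = ∃[ e ] (Incident G e v × ∃[ i' ] (i < i' × Born e i'))

  Is21EdgeOrder : (et eu : Fin (nE G)) → Set
  Is21EdgeOrder et eu =
      Born et zero
    × (len (ear D lastIdx) ≡ 1 × Born eu lastIdx)
    × (∀ i → i < lastIdx →
          (∀ v → Inner v i → InRest i v)
        × (len (ear D i) ≡ 1 → InRest i (start (ear D i)) ⊎ InRest i (end (ear D i))))

-- A vertex v with last(v) = i has no edge outside G_i, so the (2,1) condition rules out v being
-- an inner vertex of P_i unless P_i is the final short ear ru. Hence v already lies in G_{i-1},
-- and the ear property forces it to be an endpoint of P_i. If an edge vw of P_i has both ends
-- with last = i, both ends are endpoints of P_i, so P_i is a short ear whose endpoints both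
-- miss \overline{G_i}; by the (2,1) condition this is only possible for the final ear ru.
module Submission where

open import Defs
open import Data.Fin using (Fin)
open import Data.Product using (_×_)
open import Relation.Binary.PropositionalEquality using (_≡_; _≢_)

open import Data.Nat as ℕ using (ℕ; z≤n; s≤s)
open import Data.Nat.Properties using (<⇒≱; n≮0)
open import Data.Fin using (zero; suc; inject₁; fromℕ; _<_)
open import Data.Fin.Properties
  using (any?; _<?_; _≟_; <-cmp; ≤fromℕ; suc-injective; fromℕ≢inject₁)
open import Data.Product using (_,_; proj₁; proj₂)
open import Data.Sum using (_⊎_; inj₁; inj₂)
open import Data.Empty using (⊥-elim)
open import Relation.Binary.Definitions using (tri<; tri≈; tri>)
open import Relation.Nullary using (Dec; yes; no; ¬_)
open import Relation.Nullary.Decidable using (_×-dec_)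
open import Relation.Binary.PropositionalEquality using (refl; sym; trans; cong; subst)

private
  variable
    n : ℕ
    G : Graph

fromℕ≡zero⇒≡0 : fromℕ n ≡ zero → n ≡ 0
fromℕ≡zero⇒≡0 {ℕ.zero} _ = refl

inject₁≡zero∧suc≡fromℕ⇒≡1 : (j : Fin n) → inject₁ j ≡ zero → suc j ≡ fromℕ n → n ≡ 1
inject₁≡zero∧suc≡fromℕ⇒≡1 zero _ eq = cong ℕ.suc (fromℕ≡zero⇒≡0 (sym (suc-injective eq)))

Fin-≡1-irrelevant : n ≡ 1 → (j j′ : Fin n) → j ≡ j′
Fin-≡1-irrelevant refl zero zero = refl

≡1⇒zero⊎fromℕ : n ≡ 1 → (p : Fin (ℕ.suc n)) → p ≡ zero ⊎ p ≡ fromℕ n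
≡1⇒zero⊎fromℕ refl zero       = inj₁ refl
≡1⇒zero⊎fromℕ refl (suc zero) = inj₂ refl

Joins-unique : ∀ {e} {v w a b : Fin (nV G)} → Joins G e v w → Joins G e a b
             → (a ≡ v ⊎ a ≡ w) × (b ≡ v ⊎ b ≡ w)
Joins-unique (inj₁ p) (inj₁ q) = inj₁ (cong proj₁ (trans (sym q) p)) , inj₂ (cong proj₂ (trans (sym q) p))
Joins-unique (inj₁ p) (inj₂ q) = inj₂ (cong proj₂ (trans (sym q) p)) , inj₁ (cong proj₁ (trans (sym q) p))
Joins-unique (inj₂ p) (inj₁ q) = inj₂ (cong proj₁ (trans (sym q) p)) , inj₁ (cong proj₂ (trans (sym q) p))
Joins-unique (inj₂ p) (inj₂ q) = inj₁ (cong proj₂ (trans (sym q) p)) , inj₂ (cong proj₁ (trans (sym q) p))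

Incident-step : (W : Walk G) (j : Fin (len W)) {x : Fin (nV G)} → Incident G (edge W j) x
              → vert W (inject₁ j) ≡ x ⊎ vert W (suc j) ≡ x
Incident-step W j inc with joins W j | inc
... | inj₁ q | inj₁ p = inj₁ (trans (sym (cong proj₁ q)) p)
... | inj₁ q | inj₂ p = inj₂ (trans (sym (cong proj₂ q)) p)
... | inj₂ q | inj₁ p = inj₂ (trans (sym (cong proj₁ q)) p)
... | inj₂ q | inj₂ p = inj₁ (trans (sym (cong proj₂ q)) p)

boundary⇒IsEndpoint : (W : Walk G) (p : Fin (ℕ.suc (len W)))
                    → p ≡ zero ⊎ p ≡ fromℕ (len W) → IsEndpoint W (vert W p)
boundary⇒IsEndpoint W p (inj₁ p≡0)   = inj₁ (cong (vert W) p≡0)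
boundary⇒IsEndpoint W p (inj₂ p≡len) = inj₂ (cong (vert W) p≡len)

module _ (D : EarDecomposition G) where

  InPrev? : ∀ i v → Dec (InPrev (ear D) i v)
  InPrev? i v = any? (λ i′ → (i′ <? i) ×-dec any? (λ j → vert (ear D i′) j ≟ v))

  <lastIdx⊎≡lastIdx : ∀ i → i < lastIdx D ⊎ i ≡ lastIdx D
  <lastIdx⊎≡lastIdx i with <-cmp i (lastIdx D)
  ... | tri< i<last _ _ = inj₁ i<last
  ... | tri≈ _ i≡last _ = inj₂ i≡last
  ... | tri> _ _ i>last = ⊥-elim (<⇒≱ i>last (≤fromℕ i))

  InPrev⇒boundary : ∀ i (p : Fin (ℕ.suc (len (ear D i)))) → InPrev (ear D) i (vert (ear D i) p)
                  → p ≡ zero ⊎ p ≡ fromℕ (len (ear D i))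
  InPrev⇒boundary zero    p (_ , i′<0 , _) = ⊥-elim (n≮0 i′<0)
  InPrev⇒boundary (suc i) p prev            = earᵢ-inner D (suc i) (s≤s z≤n) p prev

  IsLast⇒¬InRest : ∀ {v i} → IsLast D v i → ¬ InRest D i v
  IsLast⇒¬InRest (_ , maximal) (e , inc , i′ , i<i′ , born) = <⇒≱ i<i′ (maximal e i′ inc born)

  IsLast⇒OnWalk : ∀ {v i} → IsLast D v i → OnWalk (ear D i) v
  IsLast⇒OnWalk {i = i} ((_ , inc , j , refl) , _) with Incident-step (ear D i) j inc
  ... | inj₁ at-j  = inject₁ j , at-j
  ... | inj₂ at-j′ = suc j , at-j′

  IsLast-step : ∀ {i v w} (j : Fin (len (ear D i))) → Joins G (edge (ear D i) j) v w
              → IsLast D v i → IsLast D w i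
              → IsLast D (vert (ear D i) (inject₁ j)) i × IsLast D (vert (ear D i) (suc j)) i
  IsLast-step {i} j vw last-v last-w = IsLast-end (proj₁ step-ends) , IsLast-end (proj₂ step-ends)
    where
    step-ends = Joins-unique {G} vw (joins (ear D i) j)
    IsLast-end : ∀ {a} → a ≡ _ ⊎ a ≡ _ → IsLast D a i
    IsLast-end (inj₁ refl) = last-v
    IsLast-end (inj₂ refl) = last-w

module _ (D : EarDecomposition G) {et eu : Fin (nE G)} (order : Is21EdgeOrder D et eu) where

  private
    lastEar-short : len (ear D (lastIdx D)) ≡ 1
    lastEar-short = proj₁ (proj₁ (proj₂ order))

    eu-born-last : Born D eu (lastIdx D)
    eu-born-last = proj₂ (proj₁ (proj₂ order))

    inner-in-rest : ∀ i → i < lastIdx D → ∀ v → Inner D v i → InRest D i v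
    inner-in-rest i i<last = proj₁ (proj₂ (proj₂ order) i i<last)

    short-ear-end-in-rest : ∀ i → i < lastIdx D → len (ear D i) ≡ 1
                          → InRest D i (start (ear D i)) ⊎ InRest D i (end (ear D i))
    short-ear-end-in-rest i i<last = proj₂ (proj₂ (proj₂ order) i i<last)

  IsLast⇒InPrev : ∀ {v i} → i < lastIdx D → IsLast D v i → OnWalk (ear D i) v → InPrev (ear D) i v
  IsLast⇒InPrev {v} {i} i<last last-v on with InPrev? D i v
  ... | yes prev = prev
  ... | no ¬prev = ⊥-elim (IsLast⇒¬InRest D last-v (inner-in-rest i i<last v (on , ¬prev)))

  IsLast⇒boundary : ∀ {v i} → IsLast D v i → (p : Fin (ℕ.suc (len (ear D i))))
                  → vert (ear D i) p ≡ v → p ≡ zero ⊎ p ≡ fromℕ (len (ear D i))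
  IsLast⇒boundary {i = i} last-v p at-p with <lastIdx⊎≡lastIdx D i
  ... | inj₂ refl = ≡1⇒zero⊎fromℕ lastEar-short p
  ... | inj₁ i<last =
    InPrev⇒boundary D i p (subst (InPrev (ear D) i) (sym at-p) (IsLast⇒InPrev i<last last-v (p , at-p)))

  IsLast⇒IsEndpoint : ∀ v i → IsLast D v i → IsEndpoint (ear D i) v
  IsLast⇒IsEndpoint v i last-v with IsLast⇒OnWalk D last-v
  ... | p , refl = boundary⇒IsEndpoint (ear D i) p (IsLast⇒boundary last-v p refl)

  IsLast-step⇒spans : ∀ {i} (j : Fin (len (ear D i)))
                    → IsLast D (vert (ear D i) (inject₁ j)) i → IsLast D (vert (ear D i) (suc j)) i
                    → inject₁ j ≡ zero × suc j ≡ fromℕ (len (ear D i))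
  IsLast-step⇒spans j last-a last-b
    with IsLast⇒boundary last-a (inject₁ j) refl | IsLast⇒boundary last-b (suc j) refl
  ... | inj₂ j≡len  | _            = ⊥-elim (fromℕ≢inject₁ (sym j≡len))
  ... | inj₁ _      | inj₁ ()
  ... | inj₁ j≡zero | inj₂ j+1≡len = j≡zero , j+1≡len

  IsLast-step⇒≮lastIdx : ∀ {i} (j : Fin (len (ear D i)))
                       → IsLast D (vert (ear D i) (inject₁ j)) i → IsLast D (vert (ear D i) (suc j)) i
                       → ¬ i < lastIdx D
  IsLast-step⇒≮lastIdx {i} j last-a last-b i<last
    with IsLast-step⇒spans j last-a last-b
  ... | j≡zero , j+1≡len
    with short-ear-end-in-rest i i<last (inject₁≡zero∧suc≡fromℕ⇒≡1 j j≡zero j+1≡len)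
  ... | inj₁ start-rest =
    IsLast⇒¬InRest D (subst (λ p → IsLast D (vert (ear D i) p) i) j≡zero last-a) start-rest
  ... | inj₂ end-rest =
    IsLast⇒¬InRest D (subst (λ p → IsLast D (vert (ear D i) p) i) j+1≡len last-b) end-rest

  IsLast-both⇒≡eu : ∀ e v w i → Joins G e v w → IsLast D v i → IsLast D w i → Born D e i → e ≡ eu
  IsLast-both⇒≡eu _ _ _ i vw last-v last-w (j , refl) with <lastIdx⊎≡lastIdx D i
  ... | inj₁ i<last = ⊥-elim (IsLast-step⇒≮lastIdx j (proj₁ last-ab) (proj₂ last-ab) i<last)
    where last-ab = IsLast-step D j vw last-v last-w
  ... | inj₂ refl with eu-born-last
  ...   | j′ , refl = cong (edge (ear D i)) (Fin-≡1-irrelevant lastEar-short j j′)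

lemma4 : (G : Graph) (D : EarDecomposition G)
         (r t u : Fin (nV G)) (et eu : Fin (nE G))
         → et ≢ eu → Joins G et r t → Joins G eu r u
         → Is21EdgeOrder D et eu
         → (∀ v i → IsLast D v i → IsEndpoint (ear D i) v)
           × (∀ e v w i → Joins G e v w → IsLast D v i → IsLast D w i
                → Born D e i → e ≡ eu)
lemma4 G D r t u et eu _ _ _ order = IsLast⇒IsEndpoint D order , IsLast-both⇒≡eu D order
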